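{- Let $\pi\in\mathcal B(n)$ have area $a$ and bounce $b$. Then $P_n(a-i,b+i)\neq\emptyset$ for all integers $0\le i\le a-b$.
   Context: A Dyck path of semilength $n$ is a lattice path from $(0,0)$ to $(n,n)$ with unit north and east steps never going below $y=x$; $\mathcal D(n)$ is their set. The area $\mathbf a(\pi)$ is the number of whole unit cells between $\pi$ and the diagonal. With $h_i$ the $y$-coordinate of the east step of $\pi$ in column $i$ (strip $i-1\le x\le i$), the bounce points are $b_0=0$, $b_k=h_{b_{k-1}+1}$ until $b_m=n$, and the bounce is $\mathbf b(\pi)=\sum_{k=1}^m(n-b_k)$. $P_n(a,b)$ is the set of paths in $\mathcal D(n)$ with area $a$ and bounce $b$. $\mathcal B(n)$ is the set of $\pi\in\mathcal D(n)$ such that $\mathbf b(\tau)\ge\mathbf b(\pi)$ for every $\tau\in\mathcal D(n)$ with $\mathbf a(\tau)+\mathbf b(\tau)=\mathbf a(\pi)+\mathbf b(\pi)$. -}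

module Defs where

open import Data.Nat using (ℕ; zero; suc; _+_; _*_; _∸_; _≤_; _≤?_)
open import Data.List using (List; []; _∷_; length; map)
open import Data.Nat.ListAction using (sum)
open import Data.Product using (Σ; _×_; proj₁)
open import Relation.Binary.PropositionalEquality using (_≡_)
open import Relation.Nullary using (yes; no)

data Step : Set where
  N E : Step

-- DyckFrom k w : starting k levels above the diagonal (k = #N - #E so far),
-- the word w never goes below the diagonal and ends on it.
data DyckFrom : ℕ → List Step → Set where
  done : DyckFrom 0 []
  up   : ∀ {k w} → DyckFrom (suc k) w → DyckFrom k (N ∷ w)
  down : ∀ {k w} → DyckFrom k w → DyckFrom (suc k) (E ∷ w)

IsDyck : ℕ → List Step → Set
IsDyck n w = DyckFrom 0 w × length w ≡ 2 * n

Dyck : ℕ → Set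
Dyck n = Σ (List Step) (IsDyck n)

heightsFrom : ℕ → List Step → List ℕ
heightsFrom y []      = []
heightsFrom y (N ∷ w) = heightsFrom (suc y) w
heightsFrom y (E ∷ w) = y ∷ heightsFrom y w

heights : List Step → List ℕ
heights = heightsFrom 0

-- area: column i contributes the h_i - i whole cells between path and diagonal.
areaFrom : ℕ → List ℕ → ℕ
areaFrom i []       = 0
areaFrom i (h ∷ hs) = (h ∸ suc i) + areaFrom (suc i) hs

area : (n : ℕ) → Dyck n → ℕ
area n π = areaFrom 0 (heights (proj₁ π))

-- 1-indexed lookup h_j (0 if out of range; never happens for Dyck paths).
hAt : List ℕ → ℕ → ℕ
hAt []       _             = 0
hAt (h ∷ hs) zero          = 0
hAt (h ∷ hs) (suc zero)    = h
hAt (h ∷ hs) (suc (suc j)) = hAt hs (suc j)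

-- bounce points b₁, …, b_m after b (b_k = h_{b_{k-1}+1}, stopping once b = n);
-- the fuel argument is n, enough since b_k > b_{k-1} for Dyck paths.
bouncePts : ℕ → ℕ → List ℕ → ℕ → List ℕ
bouncePts zero    n hs b = []
bouncePts (suc f) n hs b with n ≤? b
... | yes _ = []
... | no  _ = hAt hs (suc b) ∷ bouncePts f n hs (hAt hs (suc b))

bounce : (n : ℕ) → Dyck n → ℕ
bounce n π = sum (map (n ∸_) (bouncePts n n (heights (proj₁ π)) 0))

PNonempty : ℕ → ℕ → ℕ → Set
PNonempty n a b = Σ (Dyck n) (λ τ → area n τ ≡ a × bounce n τ ≡ b)

InB : (n : ℕ) → Dyck n → Set
InB n π = (τ : Dyck n) → area n τ + bounce n τ ≡ area n π + bounce n π → bounce n π ≤ bounce n τ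

module Submission where

-- A Dyck path is determined by its bounce path, a composition of n into blocks
-- of widths p₁ + 1, …, p_m + 1, together with the area X it has above the
-- lowest path with that bounce path. Its bounce is Σₖ (p_{k+1} + 1 + ⋯ + p_m + 1),
-- its area is Σₖ C(pₖ + 1, 2) + X, and X takes exactly the values
-- 0, …, Σₖ pₖ (p_{k+1} + 1). Passing one column from a block to the next one
-- trades a unit of area for a unit of bounce, and some such move exists while
-- bounce < area. The reverse move exists while area < bounce; when it does not
-- exist at all, the parts decrease strictly and X is small, and conjugating the
-- composition exchanges area and bounce. A path of ℬ(n) admits no reverse move,
-- since that would lower the bounce at fixed area + bounce, so both (a, b) and
-- (b, a) are realised, and walking towards the diagonal from one of them reaches
-- every (a − i, b + i).

open import Defs
open import Data.Nat
open import Data.Nat.Properties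
open import Data.Nat.Tactic.RingSolver using (solve-∀)
open import Data.Nat.ListAction using (sum)
open import Data.List using (List; []; _∷_; _++_; length; map; replicate; take; drop)
open import Data.List.Properties
  using (++-assoc; length-++; length-map; length-replicate; take++drop≡id; length-take; length-drop)
open import Data.List.Relation.Unary.All as All using (All; []; _∷_)
open import Data.List.Relation.Unary.All.Properties using (replicate⁺; map⁺)
open import Data.List.Relation.Unary.Linked as Linked using (Linked; []; [-]; _∷_)
open import Data.Product using (Σ; _×_; _,_; proj₁; proj₂)
open import Data.Sum using (_⊎_; inj₁; inj₂)
open import Data.Empty using (⊥-elim)
open import Data.Unit using (⊤; tt)
open import Function using (_∘_)
open import Relation.Binary.PropositionalEquality
open import Relation.Nullary using (¬_; yes; no)

-- Codes of bounce paths

choose₂ : ℕ → ℕ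
choose₂ zero    = zero
choose₂ (suc n) = n + choose₂ n

-- Part p of a code stands for a bounce block of width p + 1.
width : List ℕ → ℕ
width []      = 0
width (p ∷ α) = suc p + width α

minArea : List ℕ → ℕ
minArea []      = 0
minArea (p ∷ α) = choose₂ (suc p) + minArea α

codeBounce : List ℕ → ℕ
codeBounce []      = 0
codeBounce (p ∷ α) = width α + codeBounce α

headWidth : List ℕ → ℕ
headWidth []      = 0
headWidth (q ∷ _) = suc q

-- The block of width p + 1 followed by one of width q + 1 leaves room for
-- p (q + 1) cells above the lowest path with this bounce path.
maxExtra : List ℕ → ℕ
maxExtra []      = 0
maxExtra (p ∷ α) = p * headWidth α + maxExtra α

lastPart : List ℕ → ℕ
lastPart []          = 0
lastPart (p ∷ [])    = p
lastPart (p ∷ q ∷ α) = lastPart (q ∷ α)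

record Code (n a b : ℕ) : Set where
  constructor code
  field
    parts      : List ℕ
    extra      : ℕ
    extra≤max  : extra ≤ maxExtra parts
    width≡     : width parts ≡ n
    area≡      : minArea parts + extra ≡ a
    bounce≡    : codeBounce parts ≡ b

width-++ : ∀ α β → width (α ++ β) ≡ width α + width β
width-++ []      β = refl
width-++ (p ∷ α) β = trans (cong (suc p +_) (width-++ α β)) (sym (+-assoc (suc p) (width α) (width β)))

minArea-++ : ∀ α β → minArea (α ++ β) ≡ minArea α + minArea β
minArea-++ []      β = refl
minArea-++ (p ∷ α) β =
  trans (cong (choose₂ (suc p) +_) (minArea-++ α β)) (sym (+-assoc (choose₂ (suc p)) (minArea α) (minArea β)))

codeBounce-++ : ∀ α β → codeBounce (α ++ β) ≡ codeBounce α + length α * width β + codeBounce β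
codeBounce-++ []      β = refl
codeBounce-++ (p ∷ α) β rewrite width-++ α β | codeBounce-++ α β =
  rearrange (width α) (width β) (codeBounce α) (codeBounce β) (length α)
  where
  rearrange : ∀ wα wβ bα bβ l → (wα + wβ) + (bα + l * wβ + bβ) ≡ (wα + bα) + (wβ + l * wβ) + bβ
  rearrange = solve-∀

maxExtra-++ : ∀ α β → maxExtra (α ++ β) ≡ maxExtra α + lastPart α * headWidth β + maxExtra β
maxExtra-++ []          β = refl
maxExtra-++ (p ∷ [])    β rewrite *-zeroʳ p = refl
maxExtra-++ (p ∷ q ∷ α) β rewrite maxExtra-++ (q ∷ α) β =
  rearrange (p * suc q) (maxExtra (q ∷ α)) (lastPart (q ∷ α) * headWidth β) (maxExtra β)
  where
  rearrange : ∀ a b c d → a + (b + c + d) ≡ a + b + c + d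
  rearrange = solve-∀

-- Moving columns between blocks

-- Moves one column from the block p = suc u to the following block.
passColumn : ℕ → List ℕ → List ℕ
passColumn u []      = u ∷ 0 ∷ []
passColumn u (q ∷ s) = u ∷ suc q ∷ s

width-passColumn : ∀ u s → width (passColumn u s) ≡ width (suc u ∷ s)
width-passColumn u []      = rearrange u
  where
  rearrange : ∀ u → suc u + (1 + 0) ≡ suc (suc u) + 0
  rearrange = solve-∀
width-passColumn u (q ∷ s) = rearrange u q (width s)
  where
  rearrange : ∀ u q w → suc u + (suc (suc q) + w) ≡ suc (suc u) + (suc q + w)
  rearrange = solve-∀

codeBounce-passColumn : ∀ u s → codeBounce (passColumn u s) ≡ suc (codeBounce (suc u ∷ s))
codeBounce-passColumn u []      = refl
codeBounce-passColumn u (q ∷ s) = refl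

minArea-passColumn : ∀ u s → minArea (passColumn u s) + suc u ≡ minArea (suc u ∷ s) + headWidth s
minArea-passColumn u []      = rearrange (choose₂ (suc u)) u
  where
  rearrange : ∀ c u → c + (0 + 0) + suc u ≡ suc u + c + 0 + 0
  rearrange = solve-∀
minArea-passColumn u (q ∷ s) = rearrange (choose₂ (suc u)) (choose₂ (suc q)) (minArea s) u q
  where
  rearrange : ∀ a b l u q → a + ((suc q + b) + l) + suc u ≡ (suc u + a) + (b + l) + suc q
  rearrange = solve-∀

maxExtra-passColumn : ∀ u s →
  maxExtra (passColumn u s) + headWidth s ≡ maxExtra (suc u ∷ s) + u + headWidth (drop 1 s)
maxExtra-passColumn u []      = rearrange u
  where
  rearrange : ∀ u → u * 1 + (0 * 0 + 0) + 0 ≡ (suc u * 0 + 0) + u + 0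
  rearrange = solve-∀
maxExtra-passColumn u (q ∷ s) = rearrange u q (headWidth s) (maxExtra s)
  where
  rearrange : ∀ u q h d →
    (u * suc (suc q) + (suc q * h + d)) + suc q ≡ (suc u * suc q + (q * h + d)) + u + h
  rearrange = solve-∀

headWidth-passColumn : ∀ u s → headWidth (passColumn u s) ≡ suc u
headWidth-passColumn u []      = refl
headWidth-passColumn u (q ∷ s) = refl

passColumn-areaBalance : ∀ P F S u h Y X → F + suc u ≡ S + h → h + Y ≡ X + u → suc (P + F + Y) ≡ P + S + X
passColumn-areaBalance P F S u h Y X e₁ e₂ = +-cancelʳ-≡ (u + h) _ _ (begin
    suc (P + F + Y) + (u + h)   ≡⟨ rearrange₁ P F Y u h ⟩
    P + (F + suc u) + (h + Y)   ≡⟨ cong₂ (λ a b → P + a + b) e₁ e₂ ⟩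
    P + (S + h) + (X + u)       ≡⟨ rearrange₂ P S h X u ⟩
    P + S + X + (u + h)         ∎)
  where
  open ≡-Reasoning
  rearrange₁ : ∀ P F Y u h → suc (P + F + Y) + (u + h) ≡ P + (F + suc u) + (h + Y)
  rearrange₁ = solve-∀
  rearrange₂ : ∀ P S h X u → P + (S + h) + (X + u) ≡ P + S + X + (u + h)
  rearrange₂ = solve-∀

passColumn-extraBound : ∀ Y h X u c P F S h₂ → h + Y ≡ X + u → F + h ≡ S + u + h₂ →
  X + c ≤ (P + c * suc (suc u) + S) + h₂ → Y ≤ P + c * suc u + F
passColumn-extraBound Y h X u c P F S h₂ e₁ e₂ le = +-cancelʳ-≤ (h + c) Y (P + c * suc u + F) (begin
    Y + (h + c)                          ≡⟨ rearrange₁ Y h c ⟩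
    (h + Y) + c                          ≡⟨ cong (_+ c) e₁ ⟩
    (X + u) + c                          ≡⟨ rearrange₂ X u c ⟩
    (X + c) + u                          ≤⟨ +-monoˡ-≤ u le ⟩
    (P + c * suc (suc u) + S) + h₂ + u   ≡⟨ rearrange₃ P c u S h₂ ⟩
    P + c * suc u + c + (S + u + h₂)     ≡⟨ cong (λ z → P + c * suc u + c + z) (sym e₂) ⟩
    P + c * suc u + c + (F + h)          ≡⟨ rearrange₄ P c u F h ⟩
    (P + c * suc u + F) + (h + c)        ∎)
  where
  open ≤-Reasoning
  rearrange₁ : ∀ Y h c → Y + (h + c) ≡ (h + Y) + c
  rearrange₁ = solve-∀
  rearrange₂ : ∀ X u c → (X + u) + c ≡ (X + c) + u
  rearrange₂ = solve-∀
  rearrange₃ : ∀ P c u S h₂ → (P + c * suc (suc u) + S) + h₂ + u ≡ P + c * suc u + c + (S + u + h₂)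
  rearrange₃ = solve-∀
  rearrange₄ : ∀ P c u F h → P + c * suc u + c + (F + h) ≡ (P + c * suc u + F) + (h + c)
  rearrange₄ = solve-∀

OneMoreBounce : List ℕ → ℕ → Set
OneMoreBounce α X = Σ (List ℕ) λ β → Σ ℕ λ Y →
  Y ≤ maxExtra β × width β ≡ width α × suc (minArea β + Y) ≡ minArea α + X × codeBounce β ≡ suc (codeBounce α)

passColumn-move : ∀ pre u s X → headWidth s ≤ X + u →
  X + lastPart pre ≤ maxExtra (pre ++ suc u ∷ s) + headWidth (drop 1 s) →
  OneMoreBounce (pre ++ suc u ∷ s) X
passColumn-move pre u s X h≤ X≤ = pre ++ passColumn u s , Y , Y≤ , width≡ , area≡ , bounce≡
  where
  Y = X + u ∸ headWidth s
  h+Y : headWidth s + Y ≡ X + u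
  h+Y = m+[n∸m]≡n h≤
  ℓ = lastPart pre
  Y≤ : Y ≤ maxExtra (pre ++ passColumn u s)
  Y≤ rewrite maxExtra-++ pre (passColumn u s) | headWidth-passColumn u s =
    passColumn-extraBound Y (headWidth s) X u ℓ (maxExtra pre) (maxExtra (passColumn u s)) (maxExtra (suc u ∷ s))
      (headWidth (drop 1 s)) h+Y (maxExtra-passColumn u s)
      (subst (λ z → X + ℓ ≤ z + headWidth (drop 1 s)) (maxExtra-++ pre (suc u ∷ s)) X≤)
  width≡ : width (pre ++ passColumn u s) ≡ width (pre ++ suc u ∷ s)
  width≡ rewrite width-++ pre (passColumn u s) | width-++ pre (suc u ∷ s) | width-passColumn u s = refl
  area≡ : suc (minArea (pre ++ passColumn u s) + Y) ≡ minArea (pre ++ suc u ∷ s) + X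
  area≡ rewrite minArea-++ pre (passColumn u s) | minArea-++ pre (suc u ∷ s) =
    passColumn-areaBalance (minArea pre) (minArea (passColumn u s)) (minArea (suc u ∷ s)) u (headWidth s) Y X
      (minArea-passColumn u s) h+Y
  bounce≡ : codeBounce (pre ++ passColumn u s) ≡ suc (codeBounce (pre ++ suc u ∷ s))
  bounce≡ rewrite codeBounce-++ pre (passColumn u s) | codeBounce-++ pre (suc u ∷ s)
                | width-passColumn u s | codeBounce-passColumn u s = +-suc _ _

returnColumn : ℕ → ℕ → List ℕ → List ℕ
returnColumn u (suc q) s = suc u ∷ q ∷ s
returnColumn u zero    s = suc u ∷ s

-- A block of width one can only be emptied if it is the last one.
Returnable : ℕ → List ℕ → Set
Returnable q s = 0 < q ⊎ s ≡ []

width-returnColumn : ∀ u q s → Returnable q s → width (returnColumn u q s) ≡ width (u ∷ q ∷ s)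
width-returnColumn u (suc q) s _ = rearrange u q (width s)
  where
  rearrange : ∀ u q w → suc (suc u) + (suc q + w) ≡ suc u + (suc (suc q) + w)
  rearrange = solve-∀
width-returnColumn u zero [] _ = rearrange u
  where
  rearrange : ∀ u → suc (suc u) + 0 ≡ suc u + (1 + 0)
  rearrange = solve-∀
width-returnColumn u zero (_ ∷ _) (inj₁ ())
width-returnColumn u zero (_ ∷ _) (inj₂ ())

codeBounce-returnColumn : ∀ u q s → Returnable q s → suc (codeBounce (returnColumn u q s)) ≡ codeBounce (u ∷ q ∷ s)
codeBounce-returnColumn u (suc q) s       _        = refl
codeBounce-returnColumn u zero    []      _        = refl
codeBounce-returnColumn u zero    (_ ∷ _) (inj₁ ())
codeBounce-returnColumn u zero    (_ ∷ _) (inj₂ ())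

minArea-returnColumn : ∀ u q s → Returnable q s → minArea (returnColumn u q s) + q ≡ minArea (u ∷ q ∷ s) + suc u
minArea-returnColumn u (suc q) s _ = rearrange (choose₂ (suc u)) (choose₂ (suc q)) (minArea s) u q
  where
  rearrange : ∀ a b l u q → (suc u + a) + (b + l) + suc q ≡ a + ((suc q + b) + l) + suc u
  rearrange = solve-∀
minArea-returnColumn u zero [] _ = rearrange (choose₂ (suc u)) u
  where
  rearrange : ∀ a u → (suc u + a) + 0 + 0 ≡ a + (0 + 0) + suc u
  rearrange = solve-∀
minArea-returnColumn u zero (_ ∷ _) (inj₁ ())
minArea-returnColumn u zero (_ ∷ _) (inj₂ ())

maxExtra-returnColumn : ∀ u q s → Returnable q s →
  maxExtra (returnColumn u q s) + headWidth s + u ≡ maxExtra (u ∷ q ∷ s) + q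
maxExtra-returnColumn u (suc q) s _ = rearrange u q (headWidth s) (maxExtra s)
  where
  rearrange : ∀ u q h d →
    (suc u * suc q + (q * h + d)) + h + u ≡ (u * suc (suc q) + (suc q * h + d)) + suc q
  rearrange = solve-∀
maxExtra-returnColumn u zero [] _ = rearrange u
  where
  rearrange : ∀ u → (suc u * 0 + 0) + 0 + u ≡ (u * 1 + (0 * 0 + 0)) + 0
  rearrange = solve-∀
maxExtra-returnColumn u zero (_ ∷ _) (inj₁ ())
maxExtra-returnColumn u zero (_ ∷ _) (inj₂ ())

headWidth-returnColumn : ∀ u q s → headWidth (returnColumn u q s) ≡ suc (suc u)
headWidth-returnColumn u (suc q) s = refl
headWidth-returnColumn u zero    s = refl

returnColumn-areaBalance : ∀ P R S u q Y X → R + q ≡ S + suc u → u + Y ≡ X + q → P + R + Y ≡ suc (P + S + X)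
returnColumn-areaBalance P R S u q Y X e₁ e₂ = +-cancelʳ-≡ (q + u) _ _ (begin
    P + R + Y + (q + u)        ≡⟨ rearrange₁ P R Y q u ⟩
    P + (R + q) + (u + Y)      ≡⟨ cong₂ (λ a b → P + a + b) e₁ e₂ ⟩
    P + (S + suc u) + (X + q)  ≡⟨ rearrange₂ P S u X q ⟩
    suc (P + S + X) + (q + u)  ∎)
  where
  open ≡-Reasoning
  rearrange₁ : ∀ P R Y q u → P + R + Y + (q + u) ≡ P + (R + q) + (u + Y)
  rearrange₁ = solve-∀
  rearrange₂ : ∀ P S u X q → P + (S + suc u) + (X + q) ≡ suc (P + S + X) + (q + u)
  rearrange₂ = solve-∀

returnColumn-extraBound : ∀ Y h X u q c P R S → u + Y ≡ X + q → R + h + u ≡ S + q →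
  X + h ≤ (P + c * suc u + S) + c → Y ≤ P + c * suc (suc u) + R
returnColumn-extraBound Y h X u q c P R S e₁ e₂ le = +-cancelʳ-≤ (h + u) Y (P + c * suc (suc u) + R) (begin
    Y + (h + u)                         ≡⟨ rearrange₁ Y h u ⟩
    (u + Y) + h                         ≡⟨ cong (_+ h) e₁ ⟩
    (X + q) + h                         ≡⟨ rearrange₂ X q h ⟩
    (X + h) + q                         ≤⟨ +-monoˡ-≤ q le ⟩
    (P + c * suc u + S) + c + q         ≡⟨ rearrange₃ P c u S q ⟩
    P + c * suc (suc u) + (S + q)       ≡⟨ cong (λ z → P + c * suc (suc u) + z) (sym e₂) ⟩
    P + c * suc (suc u) + (R + h + u)   ≡⟨ rearrange₄ P c u R h ⟩
    (P + c * suc (suc u) + R) + (h + u) ∎)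
  where
  open ≤-Reasoning
  rearrange₁ : ∀ Y h u → Y + (h + u) ≡ (u + Y) + h
  rearrange₁ = solve-∀
  rearrange₂ : ∀ X q h → (X + q) + h ≡ (X + h) + q
  rearrange₂ = solve-∀
  rearrange₃ : ∀ P c u S q → (P + c * suc u + S) + c + q ≡ P + c * suc (suc u) + (S + q)
  rearrange₃ = solve-∀
  rearrange₄ : ∀ P c u R h → P + c * suc (suc u) + (R + h + u) ≡ (P + c * suc (suc u) + R) + (h + u)
  rearrange₄ = solve-∀

OneLessBounce : List ℕ → ℕ → Set
OneLessBounce α X = Σ (List ℕ) λ β → Σ ℕ λ Y →
  Y ≤ maxExtra β × width β ≡ width α × minArea β + Y ≡ suc (minArea α + X) × suc (codeBounce β) ≡ codeBounce α

returnColumn-move : ∀ pre u q s X → Returnable q s → u ≤ X + q →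
  X + headWidth s ≤ maxExtra (pre ++ u ∷ q ∷ s) + lastPart pre →
  OneLessBounce (pre ++ u ∷ q ∷ s) X
returnColumn-move pre u q s X ok u≤ X≤ = pre ++ returnColumn u q s , Y , Y≤ , width≡ , area≡ , bounce≡
  where
  Y = X + q ∸ u
  u+Y : u + Y ≡ X + q
  u+Y = m+[n∸m]≡n u≤
  ℓ = lastPart pre
  Y≤ : Y ≤ maxExtra (pre ++ returnColumn u q s)
  Y≤ rewrite maxExtra-++ pre (returnColumn u q s) | headWidth-returnColumn u q s =
    returnColumn-extraBound Y (headWidth s) X u q ℓ (maxExtra pre) (maxExtra (returnColumn u q s)) (maxExtra (u ∷ q ∷ s))
      u+Y (maxExtra-returnColumn u q s ok)
      (subst (λ z → X + headWidth s ≤ z + ℓ) (maxExtra-++ pre (u ∷ q ∷ s)) X≤)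
  width≡ : width (pre ++ returnColumn u q s) ≡ width (pre ++ u ∷ q ∷ s)
  width≡ rewrite width-++ pre (returnColumn u q s) | width-++ pre (u ∷ q ∷ s) | width-returnColumn u q s ok = refl
  area≡ : minArea (pre ++ returnColumn u q s) + Y ≡ suc (minArea (pre ++ u ∷ q ∷ s) + X)
  area≡ rewrite minArea-++ pre (returnColumn u q s) | minArea-++ pre (u ∷ q ∷ s) =
    returnColumn-areaBalance (minArea pre) (minArea (returnColumn u q s)) (minArea (u ∷ q ∷ s)) u q Y X
      (minArea-returnColumn u q s ok) u+Y
  bounce≡ : suc (codeBounce (pre ++ returnColumn u q s)) ≡ codeBounce (pre ++ u ∷ q ∷ s)
  bounce≡ rewrite codeBounce-++ pre (returnColumn u q s) | codeBounce-++ pre (u ∷ q ∷ s)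
                | width-returnColumn u q s ok | sym (codeBounce-returnColumn u q s ok) = sym (+-suc _ _)

Blocked : ℕ → List ℕ → Set
Blocked X []          = ⊤
Blocked X (zero ∷ s)  = Blocked X s
Blocked X (suc u ∷ s) = X + u < headWidth s × Blocked X s

PassSite : ℕ → List ℕ → Set
PassSite X α = Σ (List ℕ) λ pre → Σ ℕ λ u → Σ (List ℕ) λ s → α ≡ pre ++ suc u ∷ s × headWidth s ≤ X + u

passSite-or-blocked : ∀ X α → PassSite X α ⊎ Blocked X α
passSite-or-blocked X [] = inj₂ tt
passSite-or-blocked X (zero ∷ s) with passSite-or-blocked X s
... | inj₁ (pre , u , s′ , refl , le) = inj₁ (zero ∷ pre , u , s′ , refl , le)
... | inj₂ b = inj₂ b
passSite-or-blocked X (suc u ∷ s) with headWidth s ≤? X + u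
... | yes le = inj₁ ([] , u , s , refl , le)
... | no nle with passSite-or-blocked X s
...   | inj₁ (pre , u′ , s′ , refl , le) = inj₁ (suc u ∷ pre , u′ , s′ , refl , le)
...   | inj₂ b = inj₂ (≰⇒> nle , b)

-- With extra area X + 1, a nonzero part is followed by a nonzero part, so by
-- induction from the end all parts vanish.
blocked-suc⇒headWidth≤1 : ∀ X α → Blocked (suc X) α → headWidth α ≤ 1
blocked-suc⇒headWidth≤1 X []          _        = z≤n
blocked-suc⇒headWidth≤1 X (zero ∷ s)  _        = ≤-refl
blocked-suc⇒headWidth≤1 X (suc u ∷ s) (lt , b) =
  ⊥-elim (2+n≰1 (≤-trans lt (blocked-suc⇒headWidth≤1 X s b)))
  where
  2+n≰1 : ¬ (suc (suc X + u) ≤ 1)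
  2+n≰1 (s≤s ())

blocked-choose₂≤width : ∀ p α → Blocked 0 α → p ≤ headWidth α → choose₂ (suc p) ≤ width α
blocked-choose₂≤width zero    α                _        _         = z≤n
blocked-choose₂≤width (suc p) (zero ∷ α)       b        (s≤s z≤n) =
  +-mono-≤ (s≤s z≤n) (blocked-choose₂≤width zero α b z≤n)
blocked-choose₂≤width (suc p) (suc w ∷ α)      (lt , b) (s≤s le)  =
  +-mono-≤ (s≤s le) (blocked-choose₂≤width p α b (≤-trans le lt))

blocked⇒minArea≤codeBounce : ∀ α → Blocked 0 α → minArea α ≤ codeBounce α
blocked⇒minArea≤codeBounce []          _        = z≤n
blocked⇒minArea≤codeBounce (zero ∷ α)  b        =
  +-mono-≤ (blocked-choose₂≤width zero α b z≤n) (blocked⇒minArea≤codeBounce α b)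
blocked⇒minArea≤codeBounce (suc u ∷ α) (lt , b) =
  +-mono-≤ (blocked-choose₂≤width (suc u) α b lt) (blocked⇒minArea≤codeBounce α b)

passColumn-room : ∀ u₀ pre u s X → headWidth (pre ++ suc u ∷ s) > X + u₀ →
  X + lastPart (suc u₀ ∷ pre) ≤ maxExtra (suc u₀ ∷ pre ++ suc u ∷ s)
passColumn-room u₀ [] u s X gt = begin
    X + suc u₀                              ≤⟨ +-monoˡ-≤ (suc u₀) X≤ ⟩
    suc u + suc u₀                          ≡⟨ +-suc (suc u) u₀ ⟩
    suc (suc u) + u₀                        ≤⟨ +-monoʳ-≤ (suc (suc u)) (m≤m*n u₀ (suc (suc u))) ⟩
    suc (suc u) + u₀ * suc (suc u)          ≤⟨ m≤m+n _ _ ⟩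
    suc u₀ * suc (suc u) + maxExtra (suc u ∷ s) ∎
  where
  open ≤-Reasoning
  X≤ : X ≤ suc u
  X≤ = ≤-trans (m≤m+n X u₀) (≤-pred gt)
passColumn-room u₀ (y ∷ pre) u s X gt = begin
    X + ℓ                         ≤⟨ +-monoˡ-≤ ℓ X≤ ⟩
    suc u₀ * suc y + ℓ            ≤⟨ +-monoʳ-≤ (suc u₀ * suc y) ℓ≤ ⟩
    suc u₀ * suc y + (maxExtra (y ∷ pre) + ℓ * suc (suc u) + maxExtra (suc u ∷ s))
                                  ≡⟨ cong (suc u₀ * suc y +_) (sym (maxExtra-++ (y ∷ pre) (suc u ∷ s))) ⟩
    suc u₀ * suc y + maxExtra (y ∷ pre ++ suc u ∷ s) ∎
  where
  open ≤-Reasoning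
  ℓ = lastPart (y ∷ pre)
  X≤ : X ≤ suc u₀ * suc y
  X≤ = ≤-trans (≤-trans (m≤m+n X u₀) (≤-pred gt)) (≤-trans (n≤1+n y) (m≤n*m (suc y) (suc u₀)))
  ℓ≤ : ℓ ≤ maxExtra (y ∷ pre) + ℓ * suc (suc u) + maxExtra (suc u ∷ s)
  ℓ≤ = ≤-trans (m≤m*n ℓ (suc (suc u))) (≤-trans (m≤n+m _ (maxExtra (y ∷ pre))) (m≤m+n _ _))

oneMoreBounce-∷0 : ∀ α X → OneMoreBounce α X → OneMoreBounce (zero ∷ α) X
oneMoreBounce-∷0 α X (β , Y , Y≤ , width≡ , area≡ , bounce≡) = zero ∷ β , Y , Y≤ , cong suc width≡ , area≡ , bounce≡′
  where
  bounce≡′ : width β + codeBounce β ≡ suc (width α + codeBounce α)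
  bounce≡′ rewrite width≡ | bounce≡ = +-suc (width α) (codeBounce α)

oneMoreBounce : ∀ α X → X ≤ maxExtra α → codeBounce α < minArea α + X → OneMoreBounce α X
oneMoreBounce [] X X≤ lt = ⊥-elim (1+n≰n (≤-trans lt X≤))
oneMoreBounce (zero ∷ α) X X≤ lt =
  oneMoreBounce-∷0 α X (oneMoreBounce α X X≤ (≤-trans (s≤s (m≤n+m (codeBounce α) (width α))) lt))
oneMoreBounce (suc u₀ ∷ α) X X≤ lt with headWidth α ≤? X + u₀
... | yes le = passColumn-move [] u₀ α X le (≤-trans (≤-reflexive (+-identityʳ X)) (≤-trans X≤ (m≤m+n _ _)))
... | no nle with passSite-or-blocked X α
...   | inj₁ (pre , u , s , refl , le) =
        passColumn-move (suc u₀ ∷ pre) u s X le (≤-trans (passColumn-room u₀ pre u s X (≰⇒> nle)) (m≤m+n _ _))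
oneMoreBounce (suc u₀ ∷ α) zero    X≤ lt | no nle | inj₂ b =
  ⊥-elim (<⇒≱ lt (≤-trans (≤-reflexive (+-identityʳ _)) (blocked⇒minArea≤codeBounce (suc u₀ ∷ α) (≰⇒> nle , b))))
oneMoreBounce (suc u₀ ∷ α) (suc X) X≤ lt | no nle | inj₂ b =
  ⊥-elim (nle (≤-trans (blocked-suc⇒headWidth≤1 X α b) (s≤s z≤n)))

areaToBounce : ∀ {n a b} → Code n (suc a) b → b ≤ a → Code n a (suc b)
areaToBounce (code α X X≤ width≡ area≡ bounce≡) b≤a
  with oneMoreBounce α X X≤ (subst₂ _<_ (sym bounce≡) (sym area≡) (s≤s b≤a))
... | β , Y , Y≤ , width≡′ , area≡′ , bounce≡′ =
  code β Y Y≤ (trans width≡′ width≡) (suc-injective (trans area≡′ area≡)) (trans bounce≡′ (cong suc bounce≡))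

Decreasing : List ℕ → Set
Decreasing = Linked _>_

-- The reverse move between the last two parts u, q is impossible: X + q < u.
SmallExtra : ℕ → List ℕ → Set
SmallExtra X []              = X ≡ 0
SmallExtra X (p ∷ [])        = X ≡ 0
SmallExtra X (u ∷ q ∷ [])    = X + suc q ≤ u
SmallExtra X (u ∷ q ∷ w ∷ α) = SmallExtra X (q ∷ w ∷ α)

returnLast-or-smallExtra : ∀ pre u q s X → X ≤ maxExtra (pre ++ u ∷ q ∷ s) →
  OneLessBounce (pre ++ u ∷ q ∷ s) X ⊎ SmallExtra X (u ∷ q ∷ s)
returnLast-or-smallExtra pre u q [] X X≤ with u ≤? X + q
... | yes le = inj₁ (returnColumn-move pre u q [] X (inj₂ refl) le
                       (≤-trans (≤-reflexive (+-identityʳ X)) (≤-trans X≤ (m≤m+n _ _))))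
... | no nle = inj₂ (subst (_≤ u) (sym (+-suc X q)) (≰⇒> nle))
returnLast-or-smallExtra pre u q (w ∷ s) X X≤
  with returnLast-or-smallExtra (pre ++ u ∷ []) q w s X
         (subst (λ α → X ≤ maxExtra α) (sym (++-assoc pre (u ∷ []) (q ∷ w ∷ s))) X≤)
... | inj₁ r = inj₁ (subst (λ α → OneLessBounce α X) (++-assoc pre (u ∷ []) (q ∷ w ∷ s)) r)
... | inj₂ small = inj₂ small

oneLessBounce-or-smallExtra : ∀ α X → X ≤ maxExtra α → OneLessBounce α X ⊎ SmallExtra X α
oneLessBounce-or-smallExtra []          X X≤ = inj₂ (n≤0⇒n≡0 X≤)
oneLessBounce-or-smallExtra (p ∷ [])    X X≤ = inj₂ (n≤0⇒n≡0 (subst (X ≤_) (trans (+-identityʳ _) (*-zeroʳ p)) X≤))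
oneLessBounce-or-smallExtra (u ∷ q ∷ s) X X≤ = returnLast-or-smallExtra [] u q s X X≤

Ascent : List ℕ → Set
Ascent α = Σ (List ℕ) λ pre → Σ ℕ λ u → Σ ℕ λ q → Σ (List ℕ) λ s →
  α ≡ pre ++ u ∷ q ∷ s × u ≤ q × Decreasing (q ∷ s)

decreasing-or-ascent : ∀ α → Decreasing α ⊎ Ascent α
decreasing-or-ascent []          = inj₁ []
decreasing-or-ascent (p ∷ [])    = inj₁ [-]
decreasing-or-ascent (p ∷ q ∷ s) with decreasing-or-ascent (q ∷ s)
... | inj₂ (pre , u , q′ , s′ , eq , le , dec) = inj₂ (p ∷ pre , u , q′ , s′ , cong (p ∷_) eq , le , dec)
... | inj₁ dec with q <? p
...   | yes lt = inj₁ (lt ∷ dec)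
...   | no nlt = inj₂ ([] , p , q , s , refl , ≮⇒≥ nlt , dec)

smallExtra-suffix : ∀ pre α X → 2 ≤ length α → SmallExtra X (pre ++ α) → SmallExtra X α
smallExtra-suffix []        α X len small = small
smallExtra-suffix (p ∷ pre) α X len small =
  smallExtra-suffix pre α X len (smallExtra-tail p (pre ++ α) long small)
  where
  long : 2 ≤ length (pre ++ α)
  long = ≤-trans len (subst (length α ≤_) (sym (length-++ pre)) (m≤n+m _ _))
  smallExtra-tail : ∀ p α → 2 ≤ length α → SmallExtra X (p ∷ α) → SmallExtra X α
  smallExtra-tail p (q ∷ w ∷ α) _          small = small
  smallExtra-tail p (q ∷ [])    (s≤s ()) _

decreasing-smallExtra-bound : ∀ q w s X → Decreasing (q ∷ w ∷ s) → SmallExtra X (q ∷ w ∷ s) →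
  X + suc w ≤ maxExtra (q ∷ w ∷ s)
decreasing-smallExtra-bound q w [] X _ small = ≤-trans small (≤-trans (m≤m*n q (suc w)) (m≤m+n _ _))
decreasing-smallExtra-bound (suc q) w (v ∷ s) X (_ ∷ dec) small = begin
    X + suc w                        ≤⟨ +-monoˡ-≤ (suc w) (≤-trans (m≤m+n X (suc v)) ih) ⟩
    maxExtra (w ∷ v ∷ s) + suc w     ≡⟨ +-comm _ (suc w) ⟩
    suc w + maxExtra (w ∷ v ∷ s)     ≤⟨ +-monoˡ-≤ _ (m≤n*m (suc w) (suc q)) ⟩
    suc q * suc w + maxExtra (w ∷ v ∷ s) ∎
  where
  open ≤-Reasoning
  ih = decreasing-smallExtra-bound w v s X dec small
decreasing-smallExtra-bound zero w (v ∷ s) X (() ∷ _) small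

Rigid : List ℕ → ℕ → Set
Rigid α X = Decreasing α × SmallExtra X α

oneLessBounce-or-rigid : ∀ α X → X ≤ maxExtra α → OneLessBounce α X ⊎ Rigid α X
oneLessBounce-or-rigid α X X≤ with oneLessBounce-or-smallExtra α X X≤
... | inj₁ r = inj₁ r
... | inj₂ small with decreasing-or-ascent α
...   | inj₁ dec = inj₂ (dec , small)
...   | inj₂ (pre , u , q , [] , refl , u≤q , dec) =
          inj₁ (returnColumn-move pre u q [] X (inj₂ refl) (≤-trans u≤q (m≤n+m q X))
                 (≤-trans (≤-reflexive (+-identityʳ X)) (≤-trans X≤ (m≤m+n _ _))))
...   | inj₂ (pre , u , q , w ∷ s , refl , u≤q , dec@(w<q ∷ _)) =
          inj₁ (returnColumn-move pre u q (w ∷ s) X (inj₁ (≤-trans (s≤s z≤n) w<q)) (≤-trans u≤q (m≤n+m q X)) room)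
  where
  open ≤-Reasoning
  room : X + suc w ≤ maxExtra (pre ++ u ∷ q ∷ w ∷ s) + lastPart pre
  room = begin
    X + suc w                          ≤⟨ decreasing-smallExtra-bound q w s X dec
                                            (smallExtra-suffix pre (u ∷ q ∷ w ∷ s) X (s≤s (s≤s z≤n)) small) ⟩
    maxExtra (q ∷ w ∷ s)               ≤⟨ m≤n+m _ (u * suc q) ⟩
    maxExtra (u ∷ q ∷ w ∷ s)           ≤⟨ m≤n+m _ (maxExtra pre + lastPart pre * suc u) ⟩
    maxExtra pre + lastPart pre * suc u + maxExtra (u ∷ q ∷ w ∷ s)
                                       ≡⟨ sym (maxExtra-++ pre (u ∷ q ∷ w ∷ s)) ⟩
    maxExtra (pre ++ u ∷ q ∷ w ∷ s)    ≤⟨ m≤m+n _ _ ⟩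
    maxExtra (pre ++ u ∷ q ∷ w ∷ s) + lastPart pre ∎

choose₂-mono-≤ : ∀ {m n} → m ≤ n → choose₂ m ≤ choose₂ n
choose₂-mono-≤ {zero}          _         = z≤n
choose₂-mono-≤ {suc m} {suc n} (s≤s m≤n) = +-mono-≤ m≤n (choose₂-mono-≤ m≤n)

decreasing-headWidth≤ : ∀ p α → Decreasing (p ∷ α) → headWidth α ≤ p
decreasing-headWidth≤ p []      _         = z≤n
decreasing-headWidth≤ p (q ∷ α) (q<p ∷ _) = q<p

decreasing-width≤choose₂ : ∀ p α → Decreasing α → headWidth α ≤ p → width α ≤ choose₂ (suc p)
decreasing-width≤choose₂ p []            _   _         = z≤n
decreasing-width≤choose₂ (suc p) (w ∷ α) dec (s≤s w≤p) =
  +-mono-≤ (s≤s w≤p) (≤-trans (decreasing-width≤choose₂ w α (Linked.tail dec) (decreasing-headWidth≤ w α dec))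
                               (choose₂-mono-≤ (s≤s w≤p)))

decreasing⇒codeBounce≤minArea : ∀ α → Decreasing α → codeBounce α ≤ minArea α
decreasing⇒codeBounce≤minArea []      _   = z≤n
decreasing⇒codeBounce≤minArea (p ∷ α) dec =
  +-mono-≤ (decreasing-width≤choose₂ p α (Linked.tail dec) (decreasing-headWidth≤ p α dec))
           (decreasing⇒codeBounce≤minArea α (Linked.tail dec))

bounceToArea : ∀ {n a b} → Code n a (suc b) → a ≤ b → Code n (suc a) b
bounceToArea {a = a} {b} (code α X X≤ width≡ area≡ bounce≡) a≤b with oneLessBounce-or-rigid α X X≤
... | inj₁ (β , Y , Y≤ , width≡′ , area≡′ , bounce≡′) =
  code β Y Y≤ (trans width≡′ width≡) (trans area≡′ (cong suc area≡)) (suc-injective (trans bounce≡′ bounce≡))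
... | inj₂ (dec , _) = ⊥-elim (<⇒≱ (s≤s a≤b) (begin
    suc b         ≡⟨ sym bounce≡ ⟩
    codeBounce α  ≤⟨ decreasing⇒codeBounce≤minArea α dec ⟩
    minArea α     ≤⟨ m≤m+n _ _ ⟩
    minArea α + X ≡⟨ area≡ ⟩
    a             ∎))
  where open ≤-Reasoning

-- Conjugate codes

width-replicate0 : ∀ k → width (replicate k 0) ≡ k
width-replicate0 zero    = refl
width-replicate0 (suc k) = cong suc (width-replicate0 k)

minArea-replicate0 : ∀ k → minArea (replicate k 0) ≡ 0
minArea-replicate0 zero    = refl
minArea-replicate0 (suc k) = minArea-replicate0 k

codeBounce-replicate0 : ∀ k → codeBounce (replicate k 0) ≡ choose₂ k
codeBounce-replicate0 zero    = refl
codeBounce-replicate0 (suc k) = cong₂ _+_ (width-replicate0 k) (codeBounce-replicate0 k)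

width-replicate1 : ∀ k → width (replicate k 1) ≡ k + k
width-replicate1 zero    = refl
width-replicate1 (suc k) = cong suc (trans (cong suc (width-replicate1 k)) (sym (+-suc k k)))

minArea-replicate1 : ∀ k → minArea (replicate k 1) ≡ k
minArea-replicate1 zero    = refl
minArea-replicate1 (suc k) = cong suc (minArea-replicate1 k)

codeBounce-replicate1 : ∀ k → codeBounce (replicate k 1) ≡ choose₂ k + choose₂ k
codeBounce-replicate1 zero    = refl
codeBounce-replicate1 (suc k) rewrite width-replicate1 k | codeBounce-replicate1 k = rearrange k (choose₂ k)
  where
  rearrange : ∀ k c → k + k + (c + c) ≡ k + c + (k + c)
  rearrange = solve-∀

width-map-suc : ∀ α → width (map suc α) ≡ width α + length α
width-map-suc []      = refl
width-map-suc (p ∷ α) rewrite width-map-suc α = cong suc (rearrange p (width α) (length α))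
  where
  rearrange : ∀ p w l → suc p + (w + l) ≡ p + w + suc l
  rearrange = solve-∀

minArea-map-suc : ∀ α → minArea (map suc α) ≡ minArea α + width α
minArea-map-suc []      = refl
minArea-map-suc (p ∷ α) rewrite minArea-map-suc α = rearrange p (choose₂ p) (minArea α) (width α)
  where
  rearrange : ∀ p c m w → suc (p + (p + c) + (m + w)) ≡ p + c + m + suc (p + w)
  rearrange = solve-∀

codeBounce-map-suc : ∀ α → codeBounce (map suc α) ≡ codeBounce α + choose₂ (length α)
codeBounce-map-suc []      = refl
codeBounce-map-suc (p ∷ α) rewrite width-map-suc α | codeBounce-map-suc α =
  rearrange (width α) (length α) (codeBounce α) (choose₂ (length α))
  where
  rearrange : ∀ w l b c → w + l + (b + c) ≡ w + b + (l + c)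
  rearrange = solve-∀

choose₂-+ : ∀ m n → choose₂ (m + n) ≡ choose₂ m + choose₂ n + m * n
choose₂-+ zero    n = sym (+-identityʳ (choose₂ n))
choose₂-+ (suc m) n rewrite choose₂-+ m n = rearrange m n (choose₂ m) (choose₂ n)
  where
  rearrange : ∀ m n cm cn → m + n + (cm + cn + m * n) ≡ m + cm + cn + (n + m * n)
  rearrange = solve-∀

pairConjugate : ℕ → ℕ → ℕ → List ℕ
pairConjugate q X m = replicate q 1 ++ replicate X 0 ++ 1 ∷ replicate m 0

-- For X = 0 the conjugate is the conjugate partition of the block widths
-- (each part lowered by one); the extra area X moves the last 1 past X zeros.
conjugate : ℕ → List ℕ → List ℕ
conjugate X []              = []
conjugate X (p ∷ [])        = replicate (suc p) 0
conjugate X (u ∷ q ∷ [])    = pairConjugate q X (u ∸ (q + X))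
conjugate X (h ∷ q ∷ w ∷ α) = map suc (conjugate X (q ∷ w ∷ α)) ++ replicate (h ∸ q) 0

length-pairConjugate : ∀ q X m → length (pairConjugate q X m) ≡ q + (X + suc m)
length-pairConjugate q X m
  rewrite length-++ (replicate q 1) {replicate X 0 ++ 1 ∷ replicate m 0}
        | length-++ (replicate X 0) {1 ∷ replicate m 0}
        | length-replicate q {1} | length-replicate X {0} | length-replicate m {0} = refl

width-pairConjugate : ∀ q X m → width (pairConjugate q X m) ≡ (q + q) + (X + suc (suc m))
width-pairConjugate q X m
  rewrite width-++ (replicate q 1) (replicate X 0 ++ 1 ∷ replicate m 0)
        | width-++ (replicate X 0) (1 ∷ replicate m 0)
        | width-replicate1 q | width-replicate0 X | width-replicate0 m = refl

minArea-pairConjugate : ∀ q X m → minArea (pairConjugate q X m) ≡ suc q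
minArea-pairConjugate q X m
  rewrite minArea-++ (replicate q 1) (replicate X 0 ++ 1 ∷ replicate m 0)
        | minArea-++ (replicate X 0) (1 ∷ replicate m 0)
        | minArea-replicate1 q | minArea-replicate0 X | minArea-replicate0 m = +-comm q 1

codeBounce-pairConjugate : ∀ q X m →
  codeBounce (pairConjugate q X m) ≡ choose₂ (suc (q + X + m)) + choose₂ (suc q) + X
codeBounce-pairConjugate q X m
  rewrite codeBounce-++ (replicate q 1) (replicate X 0 ++ 1 ∷ replicate m 0)
        | codeBounce-++ (replicate X 0) (1 ∷ replicate m 0)
        | width-++ (replicate X 0) (1 ∷ replicate m 0)
        | length-replicate q {1} | length-replicate X {0}
        | width-replicate0 X | width-replicate0 m
        | codeBounce-replicate1 q | codeBounce-replicate0 X | codeBounce-replicate0 m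
        | choose₂-+ (q + X) m | choose₂-+ q X =
  rearrange q X m (choose₂ q) (choose₂ X) (choose₂ m)
  where
  rearrange : ∀ q X m cq cx cm →
    cq + cq + q * (X + suc (suc m)) + (cx + X * suc (suc m) + (m + cm))
    ≡ q + X + m + (cq + cx + q * X + cm + (q + X) * m) + (q + cq) + X
  rearrange = solve-∀

smallExtra-pair-split : ∀ u q X → X + suc q ≤ u → q + X + (u ∸ (q + X)) ≡ u
smallExtra-pair-split u q X small =
  m+[n∸m]≡n (≤-trans (≤-reflexive (+-comm q X)) (≤-trans (+-monoʳ-≤ X (n≤1+n q)) small))

length-prependPart : ∀ h q γ → q < h → length γ ≡ suc q → length (map suc γ ++ replicate (h ∸ q) 0) ≡ suc h
length-prependPart h q γ q<h len
  rewrite length-++ (map suc γ) {replicate (h ∸ q) 0} | length-map suc γ | len | length-replicate (h ∸ q) {0} =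
  cong suc (m+[n∸m]≡n (≤-trans (n≤1+n q) q<h))

length-conjugate : ∀ X p α → Rigid (p ∷ α) X → length (conjugate X (p ∷ α)) ≡ suc p
length-conjugate X p []      _ = length-replicate (suc p)
length-conjugate X u (q ∷ []) (_ , small) =
  trans (length-pairConjugate q X m)
        (trans (rearrange q X m) (cong suc (smallExtra-pair-split u q X small)))
  where
  m = u ∸ (q + X)
  rearrange : ∀ q X m → q + (X + suc m) ≡ suc (q + X + m)
  rearrange = solve-∀
length-conjugate X h (q ∷ w ∷ α) (q<h ∷ dec , small) =
  length-prependPart h q (conjugate X (q ∷ w ∷ α)) q<h (length-conjugate X q (w ∷ α) (dec , small))

SwapsStatistics : ℕ → List ℕ → List ℕ → Set
SwapsStatistics X α β = width β ≡ width α × minArea β ≡ codeBounce α × codeBounce β ≡ minArea α + X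

pairConjugate-swaps : ∀ u q X → X + suc q ≤ u → SwapsStatistics X (u ∷ q ∷ []) (conjugate X (u ∷ q ∷ []))
pairConjugate-swaps u q X small = width≡ , area≡ , bounce≡
  where
  m = u ∸ (q + X)
  split : q + X + m ≡ u
  split = smallExtra-pair-split u q X small
  rearrange₁ : ∀ q X m → (q + q) + (X + suc (suc m)) ≡ suc (q + X + m) + (suc q + 0)
  rearrange₁ = solve-∀
  rearrange₂ : ∀ q → suc q ≡ (suc q + 0) + (0 + 0)
  rearrange₂ = solve-∀
  rearrange₃ : ∀ a b X → a + b + X ≡ a + (b + 0) + X
  rearrange₃ = solve-∀
  width≡ : width (pairConjugate q X m) ≡ suc u + (suc q + 0)
  width≡ = trans (width-pairConjugate q X m)
                 (trans (rearrange₁ q X m) (cong (λ z → suc z + (suc q + 0)) split))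
  area≡ : minArea (pairConjugate q X m) ≡ (suc q + 0) + (0 + 0)
  area≡ = trans (minArea-pairConjugate q X m) (rearrange₂ q)
  bounce≡ : codeBounce (pairConjugate q X m) ≡ choose₂ (suc u) + (choose₂ (suc q) + 0) + X
  bounce≡ = trans (codeBounce-pairConjugate q X m)
                  (trans (cong (λ z → choose₂ (suc z) + choose₂ (suc q) + X) split)
                         (rearrange₃ (choose₂ (suc u)) (choose₂ (suc q)) X))

prependPart-swaps : ∀ X h q α γ → q < h → length γ ≡ suc q → SwapsStatistics X (q ∷ α) γ →
  SwapsStatistics X (h ∷ q ∷ α) (map suc γ ++ replicate (h ∸ q) 0)
prependPart-swaps X h q α γ q<h len (width≡ , area≡ , bounce≡) = width≡′ , area≡′ , bounce≡′
  where
  j = h ∸ q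
  split : q + j ≡ h
  split = m+[n∸m]≡n (≤-trans (n≤1+n q) q<h)
  rearrange₁ : ∀ w q j → w + suc q + j ≡ suc (q + j) + w
  rearrange₁ = solve-∀
  rearrange₂ : ∀ b w → b + w + 0 ≡ w + b
  rearrange₂ = solve-∀
  rearrange₃ : ∀ m X c cj qj → m + X + c + qj + cj ≡ (c + cj + qj) + m + X
  rearrange₃ = solve-∀
  width≡′ : width (map suc γ ++ replicate j 0) ≡ suc h + width (q ∷ α)
  width≡′ rewrite width-++ (map suc γ) (replicate j 0) | width-map-suc γ | width-replicate0 j | width≡ | len =
    trans (rearrange₁ (width (q ∷ α)) q j) (cong (λ z → suc z + width (q ∷ α)) split)
  area≡′ : minArea (map suc γ ++ replicate j 0) ≡ width (q ∷ α) + codeBounce (q ∷ α)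
  area≡′ rewrite minArea-++ (map suc γ) (replicate j 0) | minArea-map-suc γ | minArea-replicate0 j
               | width≡ | area≡ = rearrange₂ (codeBounce (q ∷ α)) (width (q ∷ α))
  bounce≡′ : codeBounce (map suc γ ++ replicate j 0) ≡ choose₂ (suc h) + minArea (q ∷ α) + X
  bounce≡′ rewrite codeBounce-++ (map suc γ) (replicate j 0) | codeBounce-map-suc γ | length-map suc γ
                 | width-replicate0 j | codeBounce-replicate0 j | bounce≡ | len =
    trans (rearrange₃ (minArea (q ∷ α)) X (choose₂ (suc q)) (choose₂ j) (suc q * j))
          (cong (λ z → z + minArea (q ∷ α) + X) (trans (sym (choose₂-+ (suc q) j)) (cong (λ z → choose₂ (suc z)) split)))

conjugate-swaps : ∀ X α → Rigid α X → SwapsStatistics X α (conjugate X α)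
conjugate-swaps X []       (_ , refl) = refl , refl , refl
conjugate-swaps X (p ∷ []) (_ , refl) =
  trans (width-replicate0 (suc p)) (sym (+-identityʳ _)) ,
  minArea-replicate0 (suc p) ,
  trans (codeBounce-replicate0 (suc p)) (sym (trans (+-identityʳ _) (+-identityʳ _)))
conjugate-swaps X (u ∷ q ∷ [])    (_ , small) = pairConjugate-swaps u q X small
conjugate-swaps X (h ∷ q ∷ w ∷ α) (q<h ∷ dec , small) =
  prependPart-swaps X h q (w ∷ α) (conjugate X (q ∷ w ∷ α)) q<h
    (length-conjugate X q (w ∷ α) (dec , small)) (conjugate-swaps X (q ∷ w ∷ α) (dec , small))

swap : ∀ {n a b} (c : Code n a b) → Rigid (Code.parts c) (Code.extra c) → Code n b a
swap (code α X _ width≡ area≡ bounce≡) rigid with conjugate-swaps X α rigid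
... | width≡′ , area≡′ , bounce≡′ =
  code (conjugate X α) 0 z≤n (trans width≡′ width≡) (trans (+-identityʳ _) (trans area≡′ bounce≡)) (trans bounce≡′ area≡)

bounceToArea-or-swap : ∀ {n a b} → Code n a b → (Σ ℕ λ b′ → b ≡ suc b′ × Code n (suc a) b′) ⊎ Code n b a
bounceToArea-or-swap c@(code α X X≤ width≡ area≡ bounce≡) with oneLessBounce-or-rigid α X X≤
... | inj₁ (β , Y , Y≤ , width≡′ , area≡′ , bounce≡′) =
  inj₁ (codeBounce β , trans (sym bounce≡) (sym bounce≡′) ,
        code β Y Y≤ (trans width≡′ width≡) (trans area≡′ (cong suc area≡)) refl)
... | inj₂ rigid = inj₂ (swap c rigid)

-- Column heights

-- hs are the heights of the columns i + 1, …, i′ of a path rising from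
-- height y to height y′.
Heights : ℕ → ℕ → List ℕ → ℕ → ℕ → Set
Heights i y []       i′ y′ = i ≡ i′ × y ≡ y′
Heights i y (h ∷ hs) i′ y′ = y ≤ h × suc i ≤ h × Heights (suc i) h hs i′ y′

heights-cast : ∀ {i y hs i′ y′ j z j′ z′} → i ≡ j → y ≡ z → i′ ≡ j′ → y′ ≡ z′ →
               Heights i y hs i′ y′ → Heights j z hs j′ z′
heights-cast refl refl refl refl hs = hs

heights-++ : ∀ {i y i₁ y₁ i₂ y₂} hs ks → Heights i y hs i₁ y₁ → Heights i₁ y₁ ks i₂ y₂ → Heights i y (hs ++ ks) i₂ y₂
heights-++ []       ks (refl , refl) valid   = valid
heights-++ (h ∷ hs) ks (y≤h , i<h , valid₁) valid₂ = y≤h , i<h , heights-++ hs ks valid₁ valid₂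

heights-split : ∀ {i y i₂ y₂} hs ks → Heights i y (hs ++ ks) i₂ y₂ →
  Σ ℕ λ y₁ → Heights i y hs (i + length hs) y₁ × Heights (i + length hs) y₁ ks i₂ y₂
heights-split {i} {y} [] ks valid = y , (sym (+-identityʳ i) , refl) , heights-cast (sym (+-identityʳ i)) refl refl refl valid
heights-split {i} (h ∷ hs) ks (y≤h , i<h , valid) with heights-split hs ks valid
... | y₁ , valid₁ , valid₂ =
  y₁ , (y≤h , i<h , heights-cast refl refl (sym (+-suc i (length hs))) refl valid₁) ,
  heights-cast (sym (+-suc i (length hs))) refl refl refl valid₂

heights-end : ∀ {i y i′ y′} hs → Heights i y hs i′ y′ → i′ ≡ i + length hs
heights-end {i} []       (refl , _)      = sym (+-identityʳ i)
heights-end {i} (h ∷ hs) (_ , _ , valid) = trans (heights-end hs valid) (sym (+-suc i (length hs)))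

heights-top : ∀ {i y i′ y′} hs → Heights i y hs i′ y′ → y ≤ y′
heights-top []       (_ , refl)        = ≤-refl
heights-top (h ∷ hs) (y≤h , _ , valid) = ≤-trans y≤h (heights-top hs valid)

heights-between : ∀ {i y i′ y′} hs → Heights i y hs i′ y′ → All (λ h → y ≤ h × h ≤ y′) hs
heights-between []       _                 = []
heights-between (h ∷ hs) (y≤h , _ , valid) =
  (y≤h , heights-top hs valid) ∷ All.map (λ { (h≤ , ≤y′) → ≤-trans y≤h h≤ , ≤y′ }) (heights-between hs valid)

pathFrom : ℕ → List ℕ → List Step
pathFrom y []       = []
pathFrom y (h ∷ hs) = replicate (h ∸ y) N ++ E ∷ pathFrom h hs

dyckFrom-north : ∀ k m w → DyckFrom (k + m) w → DyckFrom k (replicate m N ++ w)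
dyckFrom-north k zero    w d = subst (λ z → DyckFrom z w) (+-identityʳ k) d
dyckFrom-north k (suc m) w d = up (dyckFrom-north (suc k) m w (subst (λ z → DyckFrom z w) (+-suc k m) d))

heightsFrom-north : ∀ y m w → heightsFrom y (replicate m N ++ w) ≡ heightsFrom (y + m) w
heightsFrom-north y zero    w = cong (λ z → heightsFrom z w) (sym (+-identityʳ y))
heightsFrom-north y (suc m) w =
  trans (heightsFrom-north (suc y) m w) (cong (λ z → heightsFrom z w) (sym (+-suc y m)))

pathFrom-dyck : ∀ {i y j} hs → Heights i y hs j j → i ≤ y → DyckFrom (y ∸ i) (pathFrom y hs)
pathFrom-dyck {i} []       (refl , refl) _   = subst (λ z → DyckFrom z []) (sym (n∸n≡0 i)) done
pathFrom-dyck {i} {y} (h ∷ hs) (y≤h , i<h , valid) i≤y =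
  dyckFrom-north (y ∸ i) (h ∸ y) _ (subst (λ z → DyckFrom z (E ∷ pathFrom h hs)) climb
    (down (pathFrom-dyck hs valid i<h)))
  where
  climb : suc (h ∸ suc i) ≡ (y ∸ i) + (h ∸ y)
  climb = begin
    suc (h ∸ suc i)   ≡⟨ sym (+-∸-assoc 1 i<h) ⟩
    h ∸ i             ≡⟨ cong (_∸ i) (sym (m∸n+n≡m y≤h)) ⟩
    (h ∸ y) + y ∸ i   ≡⟨ +-∸-assoc (h ∸ y) i≤y ⟩
    (h ∸ y) + (y ∸ i) ≡⟨ +-comm (h ∸ y) (y ∸ i) ⟩
    (y ∸ i) + (h ∸ y) ∎
    where open ≡-Reasoning

length-pathFrom : ∀ {i y i′ y′} hs → Heights i y hs i′ y′ → length (pathFrom y hs) + y ≡ y′ + length hs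
length-pathFrom {y = y}       []       (_ , refl)        = sym (+-identityʳ y)
length-pathFrom {y = y} {y′ = y′} (h ∷ hs) (y≤h , _ , valid) = begin
    length (replicate (h ∸ y) N ++ E ∷ w) + y    ≡⟨ cong (_+ y) (length-++ (replicate (h ∸ y) N)) ⟩
    length (replicate (h ∸ y) N) + suc (length w) + y
                                                  ≡⟨ cong (λ z → z + suc (length w) + y) (length-replicate (h ∸ y)) ⟩
    (h ∸ y) + suc (length w) + y                  ≡⟨ rearrange (h ∸ y) (length w) y ⟩
    suc (length w + ((h ∸ y) + y))                ≡⟨ cong (λ z → suc (length w + z)) (m∸n+n≡m y≤h) ⟩
    suc (length w + h)                            ≡⟨ cong suc (length-pathFrom hs valid) ⟩
    suc (y′ + length hs)                          ≡⟨ sym (+-suc y′ (length hs)) ⟩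
    y′ + suc (length hs)                          ∎
  where
  open ≡-Reasoning
  w = pathFrom h hs
  rearrange : ∀ a b y → a + suc b + y ≡ suc (b + (a + y))
  rearrange = solve-∀

heightsFrom-pathFrom : ∀ {i y i′ y′} hs → Heights i y hs i′ y′ → heightsFrom y (pathFrom y hs) ≡ hs
heightsFrom-pathFrom         []       _                 = refl
heightsFrom-pathFrom {y = y} (h ∷ hs) (y≤h , _ , valid) =
  trans (heightsFrom-north y (h ∸ y) _)
    (trans (cong (λ z → heightsFrom z (E ∷ pathFrom h hs)) (m+[n∸m]≡n y≤h))
      (cong (h ∷_) (heightsFrom-pathFrom hs valid)))

heights-lower : ∀ {i y z j} hs → z ≤ y → y ≢ i → Heights i y hs j j → Heights i z hs j j
heights-lower []       z≤y y≢i (refl , refl) = ⊥-elim (y≢i refl)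
heights-lower (h ∷ hs) z≤y y≢i (y≤h , i<h , valid) = ≤-trans z≤y y≤h , i<h , valid

dyckFrom-heights : ∀ {k w} → DyckFrom k w → ∀ i → Σ ℕ λ j → Heights i (i + k) (heightsFrom (i + k) w) j j
dyckFrom-heights done i = i , refl , +-identityʳ i
dyckFrom-heights {k} {N ∷ w} (up d) i with dyckFrom-heights d i
... | j , valid = j , heights-lower _ (+-monoʳ-≤ i (n≤1+n k)) above
                        (subst (λ z → Heights i (i + suc k) (heightsFrom z w) j j) (+-suc i k) valid)
  where
  above : i + suc k ≢ i
  above eq = 1+n≰n (≤-trans (s≤s (m≤m+n i k)) (≤-reflexive (trans (sym (+-suc i k)) eq)))
dyckFrom-heights {suc k} {E ∷ w} (down d) i with dyckFrom-heights d (suc i)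
... | j , valid = j , ≤-refl , ≤-trans (s≤s (m≤m+n i k)) (≤-reflexive (sym (+-suc i k))) ,
                      subst (λ z → Heights (suc i) z (heightsFrom z w) j j) (sym (+-suc i k)) valid

dyckFrom-length : ∀ {k w} → DyckFrom k w → ∀ y → length w + k ≡ 2 * length (heightsFrom y w)
dyckFrom-length done y = refl
dyckFrom-length {k} {N ∷ w} (up d) y = trans (sym (+-suc (length w) k)) (dyckFrom-length d (suc y))
dyckFrom-length {suc k} {E ∷ w} (down d) y rewrite +-suc (length w) k | dyckFrom-length d y =
  rearrange (length (heightsFrom y w))
  where
  rearrange : ∀ l → suc (suc (2 * l)) ≡ 2 * suc l
  rearrange = solve-∀

-- Codes of Dyck paths

fillColumns : ℕ → ℕ → ℕ → List ℕ
fillColumns zero    q x = []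
fillColumns (suc p) q x with x ≤? p * q
... | yes _ = 0 ∷ fillColumns p q x
... | no  _ = (x ∸ p * q) ∷ replicate p q

length-fillColumns : ∀ p q x → length (fillColumns p q x) ≡ p
length-fillColumns zero    q x = refl
length-fillColumns (suc p) q x with x ≤? p * q
... | yes _ = cong suc (length-fillColumns p q x)
... | no  _ = cong suc (length-replicate p)

sum-replicate : ∀ p q → sum (replicate p q) ≡ p * q
sum-replicate zero    q = refl
sum-replicate (suc p) q = cong (q +_) (sum-replicate p q)

sum-fillColumns : ∀ p q x → x ≤ p * q → sum (fillColumns p q x) ≡ x
sum-fillColumns zero    q x x≤ = sym (n≤0⇒n≡0 x≤)
sum-fillColumns (suc p) q x x≤ with x ≤? p * q
... | yes x≤′ = sum-fillColumns p q x x≤′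
... | no  x≰  = trans (cong ((x ∸ p * q) +_) (sum-replicate p q)) (m∸n+n≡m (≤-trans (n≤1+n _) (≰⇒> x≰)))

fillColumns-≤ : ∀ p q x → x ≤ p * q → All (_≤ q) (fillColumns p q x)
fillColumns-≤ zero    q x x≤ = []
fillColumns-≤ (suc p) q x x≤ with x ≤? p * q
... | yes x≤′ = z≤n ∷ fillColumns-≤ p q x x≤′
... | no  _   = m≤n+o⇒m∸n≤o x (p * q) (subst (x ≤_) (+-comm q (p * q)) x≤) ∷ replicate⁺ p ≤-refl

linked-replicate : ∀ {e} p q → e ≤ q → Linked _≤_ (e ∷ replicate p q)
linked-replicate zero    q e≤q = [-]
linked-replicate (suc p) q e≤q = e≤q ∷ linked-replicate p q ≤-refl

fillColumns-sorted : ∀ p q x → x ≤ p * q → Linked _≤_ (0 ∷ fillColumns p q x)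
fillColumns-sorted zero    q x x≤ = [-]
fillColumns-sorted (suc p) q x x≤ with x ≤? p * q
... | yes x≤′ = z≤n ∷ fillColumns-sorted p q x x≤′
... | no  _   = z≤n ∷ linked-replicate p q (m≤n+o⇒m∸n≤o x (p * q) (subst (x ≤_) (+-comm q (p * q)) x≤))

-- Heights, from column c on, of the path with the given code whose extra
-- area X is stacked greedily onto the first blocks.
codeHeights : ℕ → List ℕ → ℕ → List ℕ
codeHeights c []      X = []
codeHeights c (p ∷ α) X =
  (c + suc p) ∷ (map ((c + suc p) +_) (fillColumns p (headWidth α) ((p * headWidth α) ⊓ X))
                 ++ codeHeights (c + suc p) α (X ∸ p * headWidth α))

-- The block p of a path starting at column c: its first column reaches the
-- bounce point c + p + 1 and its other p columns exceed it by ds.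
data Blocks : ℕ → List ℕ → List ℕ → ℕ → Set where
  []    : ∀ {c} → Blocks c [] [] 0
  block : ∀ {c p α ds hs X} → length ds ≡ p → All (_≤ headWidth α) ds → Blocks (c + suc p) hs α X →
          Blocks c ((c + suc p) ∷ (map ((c + suc p) +_) ds ++ hs)) (p ∷ α) (sum ds + X)

codeHeights-blocks : ∀ c α X → X ≤ maxExtra α → Blocks c (codeHeights c α X) α X
codeHeights-blocks c []      zero    _  = []
codeHeights-blocks c (p ∷ α) X       X≤ =
  subst (Blocks c (codeHeights c (p ∷ α) X) (p ∷ α)) split
    (block (length-fillColumns p (headWidth α) x₁) (fillColumns-≤ p (headWidth α) x₁ (m⊓n≤m _ X))
      (codeHeights-blocks (c + suc p) α (X ∸ p * headWidth α) (m≤n+o⇒m∸n≤o X (p * headWidth α) X≤)))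
  where
  x₁ = (p * headWidth α) ⊓ X
  split : sum (fillColumns p (headWidth α) x₁) + (X ∸ p * headWidth α) ≡ X
  split = trans (cong (_+ (X ∸ p * headWidth α)) (sum-fillColumns p (headWidth α) x₁ (m⊓n≤m _ X)))
                (m⊓n+n∸m≡n (p * headWidth α) X)

blocks-length : ∀ {c hs α X} → Blocks c hs α X → length hs ≡ width α
blocks-length []                              = refl
blocks-length (block {ds = ds} len _ blocks) =
  cong suc (trans (length-++ (map _ ds)) (cong₂ _+_ (trans (length-map _ ds) len) (blocks-length blocks)))

sum≤length* : ∀ q ds → All (_≤ q) ds → sum ds ≤ length ds * q
sum≤length* q []       []         = z≤n
sum≤length* q (d ∷ ds) (d≤ ∷ ds≤) = +-mono-≤ d≤ (sum≤length* q ds ds≤)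

blocks-extra≤ : ∀ {c hs α X} → Blocks c hs α X → X ≤ maxExtra α
blocks-extra≤ []                                     = z≤n
blocks-extra≤ (block {α = α} {ds = ds} refl ds≤ blocks) =
  +-mono-≤ (sum≤length* (headWidth α) ds ds≤) (blocks-extra≤ blocks)

areaFrom-++ : ∀ i hs ks → areaFrom i (hs ++ ks) ≡ areaFrom i hs + areaFrom (i + length hs) ks
areaFrom-++ i []       ks = cong (λ z → areaFrom z ks) (sym (+-identityʳ i))
areaFrom-++ i (h ∷ hs) ks rewrite areaFrom-++ (suc i) hs ks | +-suc i (length hs) =
  sym (+-assoc (h ∸ suc i) _ _)

areaFrom-shifted : ∀ i b ds → b ≡ i + length ds → areaFrom i (map (b +_) ds) ≡ choose₂ (length ds) + sum ds
areaFrom-shifted i b []       _   = refl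
areaFrom-shifted i b (d ∷ ds) b≡ rewrite areaFrom-shifted (suc i) b ds (trans b≡ (+-suc i (length ds))) = begin
    (b + d ∸ suc i) + (choose₂ l + sum ds)            ≡⟨ cong (λ z → (z + d ∸ suc i) + (choose₂ l + sum ds)) (trans b≡ (+-suc i l)) ⟩
    (suc i + l + d ∸ suc i) + (choose₂ l + sum ds)    ≡⟨ cong (λ z → (z ∸ suc i) + (choose₂ l + sum ds)) (+-assoc (suc i) l d) ⟩
    (suc i + (l + d) ∸ suc i) + (choose₂ l + sum ds)  ≡⟨ cong (_+ (choose₂ l + sum ds)) (m+n∸m≡n (suc i) (l + d)) ⟩
    (l + d) + (choose₂ l + sum ds)                    ≡⟨ rearrange l d (choose₂ l) (sum ds) ⟩
    (l + choose₂ l) + (d + sum ds)                    ∎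
  where
  open ≡-Reasoning
  l = length ds
  rearrange : ∀ l d c s → (l + d) + (c + s) ≡ (l + c) + (d + s)
  rearrange = solve-∀

blocks-area : ∀ {c hs α X} → Blocks c hs α X → areaFrom c hs ≡ minArea α + X
blocks-area []                                                    = refl
blocks-area {c} (block {p = p} {α = α} {ds = ds} {hs = hs} {X = X} refl _ blocks) = begin
    (b ∸ suc c) + areaFrom (suc c) (map (b +_) ds ++ hs)
      ≡⟨ cong₂ _+_ (trans (cong (_∸ suc c) (+-suc c p)) (m+n∸m≡n (suc c) p)) (areaFrom-++ (suc c) (map (b +_) ds) hs) ⟩
    p + (areaFrom (suc c) (map (b +_) ds) + areaFrom (suc c + length (map (b +_) ds)) hs)
      ≡⟨ cong (λ z → p + (areaFrom (suc c) (map (b +_) ds) + areaFrom z hs))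
              (trans (cong (suc c +_) (length-map (b +_) ds)) (sym (+-suc c p))) ⟩
    p + (areaFrom (suc c) (map (b +_) ds) + areaFrom b hs)
      ≡⟨ cong₂ (λ x y → p + (x + y)) (areaFrom-shifted (suc c) b ds (+-suc c p)) (blocks-area blocks) ⟩
    p + ((choose₂ p + sum ds) + (minArea α + X))
      ≡⟨ rearrange p (choose₂ p) (sum ds) (minArea α) X ⟩
    (p + choose₂ p) + minArea α + (sum ds + X) ∎
  where
  open ≡-Reasoning
  b = c + suc p
  rearrange : ∀ p c s m X → p + ((c + s) + (m + X)) ≡ (p + c) + m + (s + X)
  rearrange = solve-∀

bouncePts-done : ∀ f n hs b → n ≤ b → bouncePts f n hs b ≡ []
bouncePts-done zero    n hs b n≤b = refl
bouncePts-done (suc f) n hs b n≤b with n ≤? b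
... | yes _   = refl
... | no  n≰b = ⊥-elim (n≰b n≤b)

hAt-++ : ∀ pre h hs → hAt (pre ++ h ∷ hs) (suc (length pre)) ≡ h
hAt-++ []          h hs = refl
hAt-++ (x ∷ [])    h hs = refl
hAt-++ (x ∷ y ∷ pre) h hs = hAt-++ (y ∷ pre) h hs

bouncePts-next : ∀ f n pre h hs → length pre < n →
  bouncePts (suc f) n (pre ++ h ∷ hs) (length pre) ≡ h ∷ bouncePts f n (pre ++ h ∷ hs) h
bouncePts-next f n pre h hs c<n with n ≤? length pre
... | yes n≤c = ⊥-elim (<⇒≱ c<n n≤c)
... | no  _   rewrite hAt-++ pre h hs = refl

-- The list pre stands for the columns before c: bouncePts indexes heights
-- from the first column.
blocks-bounce : ∀ {c hs α X} → Blocks c hs α X → ∀ pre f n → length pre ≡ c → n ≡ c + width α → length α ≤ f →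
  sum (map (n ∸_) (bouncePts f n (pre ++ hs) c)) ≡ codeBounce α
blocks-bounce {c} [] pre f n _ n≡ _
  rewrite bouncePts-done f n (pre ++ []) c (≤-reflexive (trans n≡ (+-identityʳ c))) = refl
blocks-bounce (block {p = p} {α = α} {ds = ds} {hs = hs} refl _ blocks) pre (suc f) n refl n≡ (s≤s α≤f)
  = begin
    sum (map (n ∸_) (bouncePts (suc f) n (pre ++ b ∷ ks ++ hs) (length pre)))
      ≡⟨ cong (sum ∘ map (n ∸_)) (bouncePts-next f n pre b (ks ++ hs) c<n) ⟩
    (n ∸ b) + sum (map (n ∸_) (bouncePts f n (pre ++ b ∷ ks ++ hs) b))
      ≡⟨ cong₂ _+_ n∸b≡width (cong (λ us → sum (map (n ∸_) (bouncePts f n us b))) (sym (++-assoc pre (b ∷ ks) hs))) ⟩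
    width α + sum (map (n ∸_) (bouncePts f n ((pre ++ b ∷ ks) ++ hs) b))
      ≡⟨ cong (width α +_) (blocks-bounce blocks (pre ++ b ∷ ks) f n pre′-length n≡′ α≤f) ⟩
    width α + codeBounce α ∎
  where
  open ≡-Reasoning
  b = length pre + suc (length ds)
  ks = map (b +_) ds
  n≡′ : n ≡ b + width α
  n≡′ = trans n≡ (sym (+-assoc (length pre) (suc (length ds)) (width α)))
  c<n : length pre < n
  c<n = ≤-trans (s≤s (m≤m+n (length pre) (length ds + width α)))
                (≤-reflexive (trans (sym (+-suc (length pre) _)) (sym n≡)))
  n∸b≡width : n ∸ b ≡ width α
  n∸b≡width = trans (cong (_∸ b) n≡′) (m+n∸m≡n b (width α))
  pre′-length : length (pre ++ b ∷ ks) ≡ b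
  pre′-length = trans (length-++ pre) (cong (λ z → length pre + suc z) (length-map _ ds))

shifted-heights : ∀ i b e₀ q es → e₀ ≤ q → Linked _≤_ (e₀ ∷ es) → All (_≤ q) es → i + length es ≤ b →
  Σ ℕ λ e → e ≤ q × Heights i (b + e₀) (map (b +_) es) (i + length es) (b + e)
shifted-heights i b e₀ q []       e₀≤q _                 _          _    = e₀ , e₀≤q , sym (+-identityʳ i) , refl
shifted-heights i b e₀ q (e ∷ es) _    (e₀≤e ∷ sorted) (e≤q ∷ es≤) i+l≤b
  with shifted-heights (suc i) b e q es e≤q sorted es≤ (≤-trans (≤-reflexive (sym (+-suc i (length es)))) i+l≤b)
... | e′ , e′≤q , valid =
  e′ , e′≤q , +-monoʳ-≤ b e₀≤e ,
  ≤-trans (≤-trans (s≤s (m≤m+n i (length es))) (≤-trans (≤-reflexive (sym (+-suc i _))) i+l≤b)) (m≤m+n b e) ,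
  heights-cast refl refl (sym (+-suc i (length es))) refl valid

codeHeights-heights : ∀ c y α X → X ≤ maxExtra α → c ≤ y → y ≤ c + headWidth α →
  Heights c y (codeHeights c α X) (c + width α) (c + width α)
codeHeights-heights c y [] X X≤ c≤y y≤c =
  sym (+-identityʳ c) , ≤-antisym y≤c (≤-trans (≤-reflexive (+-identityʳ c)) c≤y)
codeHeights-heights c y (p ∷ α) X X≤ c≤y y≤b =
  y≤b , ≤-trans (s≤s (m≤m+n c p)) (≤-reflexive (sym (+-suc c p))) ,
  heights-++ (map (b +_) ds) (codeHeights b α (X ∸ p * headWidth α))
    (heights-cast refl (+-identityʳ _) ds-end refl (proj₂ (proj₂ excess)))
    (heights-cast refl refl (+-assoc c (suc p) (width α)) (+-assoc c (suc p) (width α))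
      (codeHeights-heights b (b + e) α (X ∸ p * headWidth α) (m≤n+o⇒m∸n≤o X (p * headWidth α) X≤)
         (m≤m+n _ e) (+-monoʳ-≤ b (proj₁ (proj₂ excess)))))
  where
  b = c + suc p
  x₁ = (p * headWidth α) ⊓ X
  ds = fillColumns p (headWidth α) x₁
  ds-end : suc c + length ds ≡ b
  ds-end = trans (cong (suc c +_) (length-fillColumns p (headWidth α) x₁)) (sym (+-suc c p))
  excess = shifted-heights (suc c) b 0 (headWidth α) ds z≤n
             (fillColumns-sorted p (headWidth α) x₁ (m⊓n≤m _ X)) (fillColumns-≤ p (headWidth α) x₁ (m⊓n≤m _ X))
             (≤-reflexive ds-end)
  e = proj₁ excess

length≤width : ∀ α → length α ≤ width α
length≤width []      = z≤n
length≤width (p ∷ α) = s≤s (≤-trans (length≤width α) (m≤n+m (width α) p))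

codePath : ∀ {n a b} → Code n a b → PNonempty n a b
codePath {n} {a} {b} (code α X X≤ refl area≡ bounce≡) = (w , dyck , w-length) , area≡′ , bounce≡′
  where
  hs = codeHeights 0 α X
  w = pathFrom 0 hs
  valid : Heights 0 0 hs (width α) (width α)
  valid = codeHeights-heights 0 0 α X X≤ z≤n z≤n
  blocks = codeHeights-blocks 0 α X X≤
  dyck : DyckFrom 0 w
  dyck = pathFrom-dyck hs valid z≤n
  w-length : length w ≡ 2 * width α
  w-length = trans (sym (+-identityʳ _)) (trans (length-pathFrom hs valid)
               (trans (cong (width α +_) (blocks-length blocks)) (cong (width α +_) (sym (+-identityʳ _)))))
  heights-w : heights w ≡ hs
  heights-w = heightsFrom-pathFrom hs valid
  area≡′ : areaFrom 0 (heights w) ≡ a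
  area≡′ rewrite heights-w = trans (blocks-area blocks) area≡
  bounce≡′ : sum (map (width α ∸_) (bouncePts (width α) (width α) (heights w) 0)) ≡ b
  bounce≡′ rewrite heights-w = trans (blocks-bounce blocks [] (width α) (width α) refl refl (length≤width α)) bounce≡

block′ : ∀ {c p α X} b ks ds hs → b ≡ c + suc p → ks ≡ map (b +_) ds → length ds ≡ p → All (_≤ headWidth α) ds →
         Blocks b hs α X → Blocks c (b ∷ ks ++ hs) (p ∷ α) (sum ds + X)
block′ b ks ds hs refl refl len ds≤ blocks = block len ds≤ blocks

map-+∸ : ∀ b ks → All (b ≤_) ks → ks ≡ map (b +_) (map (_∸ b) ks)
map-+∸ b []       []           = refl
map-+∸ b (k ∷ ks) (b≤k ∷ b≤ks) = cong₂ _∷_ (sym (m+[n∸m]≡n b≤k)) (map-+∸ b ks b≤ks)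

heights-blocks : ∀ f c y hs j → length hs ≤ f → Heights c y hs j j →
  Σ (List ℕ) λ α → Σ ℕ λ X → Blocks c hs α X × y ≤ c + headWidth α
heights-blocks f c y [] j _ (refl , refl) = [] , 0 , [] , ≤-reflexive (sym (+-identityʳ c))
heights-blocks (suc f) c y (b ∷ hs) j (s≤s hs≤f) (y≤b , c<b , valid) =
  p ∷ α , sum ds + X ,
  subst (λ z → Blocks c (b ∷ z) (p ∷ α) (sum ds + X)) (take++drop≡id p hs)
    (block′ b ks ds rest (trans (sym c+p) (sym (+-suc c p))) (map-+∸ b ks (All.map proj₁ ks-between)) ds-length ds≤
      (subst (λ z → Blocks z rest α X) ks-end blocks)) ,
  ≤-trans y≤b (≤-reflexive (trans (sym c+p) (sym (+-suc c p))))
  where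
  p = b ∸ suc c
  ks = take p hs
  rest = drop p hs
  ds = map (_∸ b) ks
  split = heights-split ks rest (subst (λ z → Heights (suc c) b z j j) (sym (take++drop≡id p hs)) valid)
  y′ = proj₁ split
  rest≤f : length rest ≤ f
  rest≤f = ≤-trans (≤-reflexive (length-drop p hs)) (≤-trans (m∸n≤m _ p) hs≤f)
  restBlocks = heights-blocks f (suc c + length ks) y′ rest j rest≤f (proj₂ (proj₂ split))
  α = proj₁ restBlocks
  X = proj₁ (proj₂ restBlocks)
  blocks = proj₁ (proj₂ (proj₂ restBlocks))
  y′≤ = proj₂ (proj₂ (proj₂ restBlocks))
  c+p : suc c + p ≡ b
  c+p = m+[n∸m]≡n c<b
  p≤length : p ≤ length hs
  p≤length = +-cancelˡ-≤ (suc c) p (length hs)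
    (≤-trans (≤-reflexive c+p) (≤-trans (heights-top hs valid) (≤-reflexive (heights-end hs valid))))
  ks-length : length ks ≡ p
  ks-length = trans (length-take p hs) (m≤n⇒m⊓n≡m p≤length)
  ds-length : length ds ≡ p
  ds-length = trans (length-map _ ks) ks-length
  ks-end : suc c + length ks ≡ b
  ks-end = trans (cong (suc c +_) ks-length) c+p
  ks-between : All (λ k → b ≤ k × k ≤ y′) ks
  ks-between = heights-between ks (proj₁ (proj₂ split))
  ds≤ : All (_≤ headWidth α) ds
  ds≤ = map⁺ (All.map (λ { (_ , k≤y′) → m≤n+o⇒m∸n≤o _ b (≤-trans k≤y′ (≤-trans y′≤ (≤-reflexive (cong (_+ headWidth α) ks-end)))) })
                      ks-between)

dyckCode : ∀ n (π : Dyck n) → Code n (area n π) (bounce n π)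
dyckCode n (w , dyck , w-length) =
  code α X (blocks-extra≤ blocks) width≡ (sym (blocks-area blocks))
       (sym (blocks-bounce blocks [] n n refl (sym width≡) (≤-trans (length≤width α) (≤-reflexive width≡))))
  where
  start = dyckFrom-heights dyck 0
  decomposition = heights-blocks (length (heights w)) 0 0 (heights w) (proj₁ start) ≤-refl (proj₂ start)
  α = proj₁ decomposition
  X = proj₁ (proj₂ decomposition)
  blocks = proj₁ (proj₂ (proj₂ decomposition))
  columns : length (heights w) ≡ n
  columns = *-cancelˡ-≡ (length (heights w)) n 2 (trans (sym (dyckFrom-length dyck 0)) (trans (+-identityʳ _) w-length))
  width≡ : width α ≡ n
  width≡ = trans (sym (blocks-length blocks)) columns

moveAreaToBounce : ∀ t {n a b} → Code n (t + a) b → b + t ≤ a → Code n a (b + t)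
moveAreaToBounce zero    {n} {a} {b} c _     = subst (Code n a) (sym (+-identityʳ b)) c
moveAreaToBounce (suc t) {n} {a} {b} c b+t<a =
  subst (Code n a) (sym (+-suc b t))
    (moveAreaToBounce t (areaToBounce c (≤-trans (≤-trans (m≤m+n b (suc t)) b+t<a) (m≤n+m a t)))
      (≤-trans (≤-reflexive (sym (+-suc b t))) b+t<a))

moveBounceToArea : ∀ t {n a b} → Code n a (t + b) → a + t ≤ b → Code n (a + t) b
moveBounceToArea zero    {n} {a} {b} c _     = subst (λ z → Code n z b) (sym (+-identityʳ a)) c
moveBounceToArea (suc t) {n} {a} {b} c a+t<b =
  subst (λ z → Code n z b) (sym (+-suc a t))
    (moveBounceToArea t (bounceToArea c (≤-trans (≤-trans (m≤m+n a (suc t)) a+t<b) (m≤n+m b t)))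
      (≤-trans (≤-reflexive (sym (+-suc a t))) a+t<b))

code-interpolate : ∀ {n a b} i → Code n a b → Code n b a → i + b ≤ a → Code n (a ∸ i) (b + i)
code-interpolate {n} {a} {b} i c c′ i+b≤a with b + i + i ≤? a
... | yes b+2i≤a =
  moveAreaToBounce i (subst (λ z → Code n z b) (sym (m+[n∸m]≡n i≤a)) c) (m+n≤o⇒m≤o∸n (b + i) b+2i≤a)
  where
  i≤a : i ≤ a
  i≤a = m+n≤o⇒m≤o i i+b≤a
... | no b+2i≰a = subst (λ z → Code n z (b + i)) b+j≡a∸i
                        (moveBounceToArea j (subst (Code n b) a≡j+b+i c′) (+-monoʳ-≤ b j≤i))
  where
  j = a ∸ (i + b)
  j+i+b≡a : j + (i + b) ≡ a
  j+i+b≡a = m∸n+n≡m i+b≤a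
  a≡j+b+i : a ≡ j + (b + i)
  a≡j+b+i = trans (sym j+i+b≡a) (cong (j +_) (+-comm i b))
  j≤i : j ≤ i
  j≤i = +-cancelʳ-≤ (i + b) j i (begin
    j + (i + b)   ≡⟨ j+i+b≡a ⟩
    a             ≤⟨ <⇒≤ (≰⇒> b+2i≰a) ⟩
    b + i + i     ≡⟨ trans (+-assoc b i i) (+-comm b (i + i)) ⟩
    i + i + b     ≡⟨ +-assoc i i b ⟩
    i + (i + b)   ∎)
    where open ≤-Reasoning
  b+j≡a∸i : b + j ≡ a ∸ i
  b+j≡a∸i = sym (begin
    a ∸ i             ≡⟨ cong (_∸ i) a≡j+b+i ⟩
    j + (b + i) ∸ i   ≡⟨ cong (_∸ i) (trans (sym (+-assoc j b i)) (cong (_+ i) (+-comm j b))) ⟩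
    b + j + i ∸ i     ≡⟨ m+n∸n≡m (b + j) i ⟩
    b + j             ∎)
    where open ≡-Reasoning

minimal-swap : ∀ n (π : Dyck n) → InB n π → Code n (bounce n π) (area n π)
minimal-swap n π minimal with bounceToArea-or-swap (dyckCode n π)
... | inj₂ c′ = c′
... | inj₁ (b′ , b≡ , c) with codePath c
...   | τ , area≡ , bounce≡ =
  ⊥-elim (1+n≰n (≤-trans (≤-reflexive (sym b≡)) (≤-trans (minimal τ same-sum) (≤-reflexive bounce≡))))
  where
  same-sum : area n τ + bounce n τ ≡ area n π + bounce n π
  same-sum = trans (cong₂ _+_ area≡ bounce≡) (trans (sym (+-suc (area n π) b′)) (cong (area n π +_) (sym b≡)))

corollary4p15 : (n : ℕ) (π : Dyck n) → InB n π →
                (i : ℕ) → i + bounce n π ≤ area n π →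
                PNonempty n (area n π ∸ i) (bounce n π + i)
corollary4p15 n π minimal i i+b≤a =
  codePath (code-interpolate i (dyckCode n π) (minimal-swap n π minimal) i+b≤a)
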